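{- There exists a set of $6$ points in general position in the plane such that the edge set of the complete geometric graph on these points can be partitioned into $4$ plane star-forests in such a way that every point is the center of at least one star (component) of one of these star-forests.
   Context: A complete geometric graph on a finite point set $P\subset\mathbb{R}^2$ in general position (no three collinear) is the complete graph on $P$ with edges drawn as straight line segments. A subgraph is plane if no two of its edges cross. A star is a connected graph on $m\ge 1$ vertices with one vertex (the center) of degree $m-1$ and all others of degree $1$ (for a single edge one endpoint is designated as center). A star-forest is a forest each of whose components is a star. -}

module Defs where

open import Data.Nat using (ℕ)
open import Data.Fin using (Fin)
open import Data.Integer using (ℤ; _-_; _*_; _<_; 0ℤ)
open import Data.Product using (_×_; _,_; proj₁; proj₂; Σ; ∃)
open import Data.Sum using (_⊎_)
open import Data.Empty using (⊥)
open import Relation.Binary.PropositionalEquality using (_≡_; _≢_)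

Point : Set
Point = ℤ × ℤ

-- Orientation determinant of (p, q, r): positive = counter-clockwise,
-- zero = collinear.
orient : Point → Point → Point → ℤ
orient (px , py) (qx , qy) (rx , ry) =
  ((qx - px) * (ry - py)) - ((qy - py) * (rx - px))

Config : ℕ → Set
Config n = Fin n → Point

-- General position: no three (distinct-index) points collinear.
-- (This also forces the points to be pairwise distinct when n ≥ 3.)
GeneralPosition : ∀ {n} → Config n → Set
GeneralPosition {n} P =
  (i j k : Fin n) → i ≢ j → j ≢ k → i ≢ k → orient (P i) (P j) (P k) ≢ 0ℤ

-- For points in general
-- position, two segments with a common endpoint meet only at that endpoint,
-- and two segments with four distinct endpoints intersect iff each one
-- separates the endpoints of the other (strict sign change of orientation).
Cross : ∀ {n} → Config n → Fin n → Fin n → Fin n → Fin n → Set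
Cross P a b c d =
  a ≢ c × a ≢ d × b ≢ c × b ≢ d ×
  (orient (P a) (P b) (P c) * orient (P a) (P b) (P d) < 0ℤ) ×
  (orient (P c) (P d) (P a) * orient (P c) (P d) (P b) < 0ℤ)

-- A partition of the edges of K_n into k classes, together with a choice of
-- a center endpoint for every edge:
--   col i j : the class (star-forest) of edge {i,j}
--   cen i j : the center endpoint of the star containing edge {i,j}
-- (only the values on pairs i ≢ j matter).
record StarForestPartition (n k : ℕ) (P : Config n) : Set where
  field
    col : Fin n → Fin n → Fin k
    cen : Fin n → Fin n → Fin n
    col-sym : ∀ i j → col i j ≡ col j i
    cen-sym : ∀ i j → cen i j ≡ cen j i
    cen-end : ∀ i j → i ≢ j → (cen i j ≡ i) ⊎ (cen i j ≡ j)
    -- Star-forest condition: if two distinct edges of the same class share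
    -- a vertex j, then j is the center of both.  Hence every class is a
    -- disjoint union of stars, whose centers are given by cen.
    star : ∀ i j l → i ≢ j → j ≢ l → i ≢ l → col i j ≡ col j l →
           (cen i j ≡ j) × (cen j l ≡ j)
    plane : ∀ a b c d → a ≢ b → c ≢ d → col a b ≡ col c d → Cross P a b c d → ⊥


EveryPointCenter : ∀ {n k P} → StarForestPartition n k P → Set
EveryPointCenter {n} S = (v : Fin n) → ∃ λ u → u ≢ v × StarForestPartition.cen S v u ≡ v

-- Every condition quantifies over finitely many
-- indices, and for integer points the geometric ones are sign conditions on
-- orientation determinants, so all of them are decided by evaluation.
module Submission where

open import Defs
open import Data.Nat using (ℕ)
open import Data.Fin using (Fin; #_)
open import Data.Fin.Properties using (all?; any?; _≟_)
open import Data.Integer using (+_; 0ℤ; _*_; _<?_)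
import Data.Integer.Properties as ℤ
open import Data.Product using (Σ; _×_; _,_)
open import Data.Sum using (_⊎_)
open import Data.Empty using (⊥)
open import Data.Vec using (Vec; []; _∷_; lookup)
open import Relation.Nullary using (Dec; no; ¬?)
open import Relation.Nullary.Decidable
  using (True; toWitness; _×-dec_; _⊎-dec_; _→-dec_)
open import Relation.Binary.PropositionalEquality using (_≡_; _≢_)

_≢?_ : ∀ {n} (i j : Fin n) → Dec (i ≢ j)
i ≢? j = ¬? (i ≟ j)

module _ {n : ℕ} (P : Config n) where

  generalPosition? : Dec (GeneralPosition P)
  generalPosition? = all? λ i → all? λ j → all? λ k →
    i ≢? j →-dec j ≢? k →-dec i ≢? k →-dec
    ¬? (orient (P i) (P j) (P k) ℤ.≟ 0ℤ)

  cross? : ∀ a b c d → Dec (Cross P a b c d)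
  cross? a b c d =
    a ≢? c ×-dec a ≢? d ×-dec b ≢? c ×-dec b ≢? d ×-dec
    (orient (P a) (P b) (P c) * orient (P a) (P b) (P d) <? 0ℤ) ×-dec
    (orient (P c) (P d) (P a) * orient (P c) (P d) (P b) <? 0ℤ)

module Labelling {n k : ℕ} (P : Config n)
                 (col : Fin n → Fin n → Fin k) (cen : Fin n → Fin n → Fin n) where

  colSym? : Dec (∀ i j → col i j ≡ col j i)
  colSym? = all? λ i → all? λ j → col i j ≟ col j i

  cenSym? : Dec (∀ i j → cen i j ≡ cen j i)
  cenSym? = all? λ i → all? λ j → cen i j ≟ cen j i

  cenEnd? : Dec (∀ i j → i ≢ j → (cen i j ≡ i) ⊎ (cen i j ≡ j))
  cenEnd? = all? λ i → all? λ j → i ≢? j →-dec (cen i j ≟ i ⊎-dec cen i j ≟ j)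

  star? : Dec (∀ i j l → i ≢ j → j ≢ l → i ≢ l → col i j ≡ col j l →
               (cen i j ≡ j) × (cen j l ≡ j))
  star? = all? λ i → all? λ j → all? λ l →
    i ≢? j →-dec j ≢? l →-dec i ≢? l →-dec col i j ≟ col j l →-dec
    (cen i j ≟ j ×-dec cen j l ≟ j)

  plane? : Dec (∀ a b c d → a ≢ b → c ≢ d → col a b ≡ col c d →
                Cross P a b c d → ⊥)
  plane? = all? λ a → all? λ b → all? λ c → all? λ d →
    a ≢? b →-dec c ≢? d →-dec col a b ≟ col c d →-dec cross? P a b c d →-dec
    no λ ()

  starForestPartition :
    {_ : True colSym?} {_ : True cenSym?} {_ : True cenEnd?}
    {_ : True star?} {_ : True plane?} → StarForestPartition n k P
  starForestPartition {cs} {ns} {ce} {st} {pl} = record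
    { col = col ; cen = cen
    ; col-sym = toWitness cs ; cen-sym = toWitness ns ; cen-end = toWitness ce
    ; star = toWitness st ; plane = toWitness pl
    }

everyPointCenter? : ∀ {n k P} (S : StarForestPartition n k P) →
                    Dec (EveryPointCenter S)
everyPointCenter? S = all? λ v → any? λ u → u ≢? v ×-dec cen v u ≟ v
  where open StarForestPartition S

points : Config 6
points = lookup
  ( (+ 7  , + 0)  ∷ (+ 6  , + 17) ∷ (+ 17 , + 7)
  ∷ (+ 12 , + 16) ∷ (+ 11 , + 18) ∷ (+ 11 , + 14) ∷ [])

-- The forests, as stars  center–{leaves}:
--   0: 0–{1,4}, 3–{2,5}    1: 2–{0,1}, 4–{3,5}
--   2: 0–{3}, 1–{5}, 2–{4}    3: 1–{3,4}, 5–{0,2}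
-- The diagonal entries of both tables are never inspected.
colour : Fin 6 → Fin 6 → Fin 4
colour i j = lookup (lookup table i) j
  where
  table : Vec (Vec (Fin 4) 6) 6
  table = (# 0 ∷ # 0 ∷ # 1 ∷ # 2 ∷ # 0 ∷ # 3 ∷ [])
        ∷ (# 0 ∷ # 0 ∷ # 1 ∷ # 3 ∷ # 3 ∷ # 2 ∷ [])
        ∷ (# 1 ∷ # 1 ∷ # 0 ∷ # 0 ∷ # 2 ∷ # 3 ∷ [])
        ∷ (# 2 ∷ # 3 ∷ # 0 ∷ # 0 ∷ # 1 ∷ # 0 ∷ [])
        ∷ (# 0 ∷ # 3 ∷ # 2 ∷ # 1 ∷ # 0 ∷ # 1 ∷ [])
        ∷ (# 3 ∷ # 2 ∷ # 3 ∷ # 0 ∷ # 1 ∷ # 0 ∷ [])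
        ∷ []

centre : Fin 6 → Fin 6 → Fin 6
centre i j = lookup (lookup table i) j
  where
  table : Vec (Vec (Fin 6) 6) 6
  table = (# 0 ∷ # 0 ∷ # 2 ∷ # 0 ∷ # 0 ∷ # 5 ∷ [])
        ∷ (# 0 ∷ # 0 ∷ # 2 ∷ # 1 ∷ # 1 ∷ # 1 ∷ [])
        ∷ (# 2 ∷ # 2 ∷ # 0 ∷ # 3 ∷ # 2 ∷ # 5 ∷ [])
        ∷ (# 0 ∷ # 1 ∷ # 3 ∷ # 0 ∷ # 4 ∷ # 3 ∷ [])
        ∷ (# 0 ∷ # 1 ∷ # 2 ∷ # 4 ∷ # 0 ∷ # 4 ∷ [])
        ∷ (# 5 ∷ # 1 ∷ # 5 ∷ # 3 ∷ # 4 ∷ # 0 ∷ [])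
        ∷ []

fourStarForests : StarForestPartition 6 4 points
fourStarForests = Labelling.starForestPartition points colour centre

lemma3 : Σ (Config 6) λ P → GeneralPosition P ×
    Σ (StarForestPartition 6 4 P) λ S → EveryPointCenter S
lemma3 = points , toWitness {a? = generalPosition? points} _ ,
         fourStarForests , toWitness {a? = everyPointCenter? fourStarForests} _
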